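{- Let $q$ be a prime power and $\alpha$ a primitive element of $\mathbb{F}_{q^5}$ (identified with $\mathbb{F}_q^5$). Then the relation $E_2$ has exactly $q^2+1$ equivalence classes, and the relation $E_3$ also has exactly $q^2+1$ equivalence classes.
   Context: For a subspace $X$ of $\mathbb{F}_q^5$ and nonzero $\beta\in\mathbb{F}_{q^5}$, $\beta X=\{\beta x:x\in X\}$. For $r\in\{2,3\}$, $E_r$ is the equivalence relation on the $r$-dimensional subspaces of $\mathbb{F}_q^5$ given by $(X,Y)\in E_r$ iff $Y=\alpha^jX$ for some integer $j$. -}

module Defs where

open import Level using (0ℓ)
open import Data.Nat using (ℕ; suc) renaming (_^_ to _^ℕ_)
open import Data.Nat.Primality using (Prime)
open import Data.Fin using (Fin)
open import Data.Bool using (Bool; true)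
open import Data.Product using (Σ; ∃; _×_; _,_)
open import Function.Bundles using (_↔_; _⇔_)
open import Relation.Nullary using (¬_)
open import Relation.Binary.PropositionalEquality using (_≡_)
open import Algebra.Structures using (IsCommutativeRing)

IsPrimePower : ℕ → Set
IsPrimePower q = Σ ℕ λ p → Σ ℕ λ k → Prime p × q ≡ p ^ℕ suc k

record Field : Set₁ where
  infixl 6 _+_
  infixl 7 _*_
  field
    Carrier : Set
    _+_ _*_ : Carrier → Carrier → Carrier
    -_      : Carrier → Carrier
    0# 1#   : Carrier
    isCommutativeRing : IsCommutativeRing _≡_ _+_ _*_ -_ 0# 1#
    0≢1     : ¬ (0# ≡ 1#)
    inverse : ∀ x → ¬ (x ≡ 0#) → Σ Carrier λ y → x * y ≡ 1#

  _^_ : Carrier → ℕ → Carrier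
  x ^ ℕ.zero  = 1#
  x ^ ℕ.suc n = x * (x ^ n)

  ∑ : ∀ {n} → (Fin n → Carrier) → Carrier
  ∑ {ℕ.zero}  f = 0#
  ∑ {ℕ.suc n} f = f Fin.zero + ∑ (λ i → f (Fin.suc i))

open Field public using () renaming (Carrier to ⟨_⟩)

HasCard : Field → ℕ → Set
HasCard F n = ⟨ F ⟩ ↔ Fin n

-- A (unital ring) homomorphism F → K, i.e. an embedding of F as a subfield of K.
record FieldHom (F K : Field) : Set where
  private
    module F = Field F
    module K = Field K
  field
    ι      : F.Carrier → K.Carrier
    ι-+    : ∀ a b → ι (a F.+ b) ≡ ι a K.+ ι b
    ι-*    : ∀ a b → ι (a F.* b) ≡ ι a K.* ι b
    ι-1    : ι F.1# ≡ K.1#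

module _ (K : Field) where
  open Field K

  IsPrimitive : Carrier → Set
  IsPrimitive α = ∀ x → ¬ (x ≡ 0#) → Σ ℕ λ j → α ^ j ≡ x

module Subspaces {F K : Field} (h : FieldHom F K) where
  private
    module F = Field F
    module K = Field K
  open FieldHom h

  Subset : Set
  Subset = K.Carrier → Bool

  _∈_ : K.Carrier → Subset → Set
  x ∈ X = X x ≡ true

  record IsSubspace (X : Subset) : Set where
    field
      zero∈ : K.0# ∈ X
      +∈    : ∀ x y → x ∈ X → y ∈ X → (x K.+ y) ∈ X
      ·∈    : ∀ c x → x ∈ X → (ι c K.* x) ∈ X

  lincomb : ∀ {r} → (Fin r → F.Carrier) → (Fin r → K.Carrier) → K.Carrier
  lincomb c b = K.∑ (λ i → ι (c i) K.* b i)

  record IsBasis {r : ℕ} (X : Subset) (b : Fin r → K.Carrier) : Set where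
    field
      in-X       : ∀ i → b i ∈ X
      independent : ∀ c → lincomb c b ≡ K.0# → ∀ i → c i ≡ F.0#
      spanning   : ∀ x → x ∈ X → Σ (Fin r → F.Carrier) λ c → lincomb c b ≡ x

  record Sub (r : ℕ) : Set where
    field
      set        : Subset
      isSubspace : IsSubspace set
      basis      : Fin r → K.Carrier
      isBasis    : IsBasis set basis
  open Sub public

  _≐_·_ : Subset → K.Carrier → Subset → Set
  Y ≐ β · X = ∀ y → (y ∈ Y) ⇔ (Σ K.Carrier λ x → x ∈ X × y ≡ β K.* x)

  -- the relation E_r : (X , Y) ∈ E_r iff Y = α^j X for some integer j.
  -- (α^j for negative j equals α^(j mod (q^5-1)) since α has finite order;
  --  quantifying over j ∈ ℕ gives the same relation.)
  E : (α : K.Carrier) {r : ℕ} → Sub r → Sub r → Set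
  E α X Y = Σ ℕ λ j → set Y ≐ (α K.^ j) · set X

HasExactlyNClasses : {A : Set} → (A → A → Set) → ℕ → Set
HasExactlyNClasses {A} R N =
  Σ (Fin N → A) λ rep →
    (∀ i j → R (rep i) (rep j) → i ≡ j) ×
    (∀ x → Σ (Fin N) λ i → R x (rep i))

-- K* acts on the r-dimensional F-subspaces of K by X ↦ βX, and the E_r-classes are its orbits.
-- For r = 2, 3 every stabilizer is exactly F*: it contains F*, and as it acts freely on X∖0 and
-- on K*, its order divides q^r − 1 and q^5 − 1, whose gcd is q − 1.  Subspaces are counted through
-- their ordered bases: the class of an independent r-tuple b (all tuples spanning some βX, X = span b)
-- is the image of K* × {bases of X} under (β, c) ↦ βc, whose fibres are copies of the stabilizer.
-- So each class has (q^5 − 1)·#bases/(q − 1) elements, and dividing the number of independent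
-- r-tuples of K by this leaves q^2 + 1 classes.

module Submission where

open import Defs
open import Level using (0ℓ)
open import Algebra.Bundles using (CommutativeRing)
import Algebra.Properties.CommutativeSemigroup as CommutativeSemigroupProperties
import Algebra.Properties.Group as GroupProperties
import Algebra.Properties.Ring as RingProperties
open import Axiom.UniquenessOfIdentityProofs using (UIP; module Decidable⇒UIP)
open import Data.Bool using (Bool; true; false; T; not; _∧_)
import Data.Bool.Properties as Bool
open import Data.Bool.Properties using (T?; T-≡; T-irrelevant)
open import Data.Empty using (⊥-elim)
open import Data.Fin as Fin using (Fin; zero; suc)
import Data.Fin.Properties as Finₚ
import Data.Nat
open import Data.Nat as ℕ using (ℕ; zero; suc; _∸_; _≤_; s≤s; z≤n)
import Data.Nat.Properties as ℕₚ
open import Data.Nat.Divisibility using (_∣_; divides; ∣m+n∣m⇒∣n; ∣n⇒∣m*n; ∣⇒≤)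
open import Data.Nat.Primality using (prime⇒nonTrivial; prime⇒nonZero)
open import Data.Nat.Tactic.RingSolver using (solve-∀)
open import Data.Product using (Σ; ∃; _×_; _,_; proj₁; proj₂; uncurry)
open import Data.Product.Function.Dependent.Propositional using (Σ-↔)
open import Data.Sum using (_⊎_; inj₁; inj₂)
open import Data.Sum.Function.Propositional using (_⊎-↔_)
open import Data.Unit using (⊤; tt)
open import Data.Vec using (Vec; []; _∷_; lookup; map; zipWith; replicate; tabulate)
import Data.Vec.Properties as Vec
open import Data.Vec.Relation.Unary.All using (All; []; _∷_)
import Data.Vec.Relation.Unary.All as All
import Data.Vec.Relation.Unary.All.Properties as All
open import Function using (_∘_; _↔_; Inverse; mk↔ₛ′; Injective; Injection)
open import Function.Bundles using (Equivalence; mk⇔)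
open import Function.Properties.Inverse using (↔-sym; ↔-trans; ↔⇒↣)
open import Relation.Binary using (DecidableEquality)
open import Relation.Binary.PropositionalEquality
open import Relation.Nullary using (¬_; ¬?; Dec; yes; no; map′; contradiction)
open import Relation.Nullary.Decidable using (⌊_⌋; toWitness; fromWitness; _×-dec_; _→-dec_; decidable-stable)
open import Relation.Unary using (Decidable)


module FiniteSets where
  open Data.Nat using (_+_; _*_; _^_)
  open ℕₚ using (≤-antisym; m+n∸m≡n; +-cancelˡ-≡; +-identityʳ)

  Card : Set → ℕ → Set
  Card A n = A ↔ Fin n

  private variable
    A B : Set
    m n c : ℕ

  ↔-injective : (e : A ↔ B) → Injective _≡_ _≡_ (Inverse.to e)
  ↔-injective e = Injection.injective (↔⇒↣ e)

  card-injective-≤ : Card A m → Card B n → (f : A → B) → Injective _≡_ _≡_ f → m ≤ n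
  card-injective-≤ eA eB f f-inj =
    Finₚ.injective⇒≤ (↔-injective (↔-sym eA) ∘ f-inj ∘ ↔-injective eB)

  card-unique : Card A m → Card A n → m ≡ n
  card-unique e e′ = ≤-antisym (card-injective-≤ e e′ (λ x → x) (λ p → p))
                               (card-injective-≤ e′ e (λ x → x) (λ p → p))

  card-empty : Card A 0 → ¬ A
  card-empty e a with Inverse.to e a
  ... | ()

  card-⊤ : Card ⊤ 1
  card-⊤ = ↔-sym Finₚ.1↔⊤

  card-⊎ : Card A m → Card B n → Card (A ⊎ B) (m + n)
  card-⊎ eA eB = ↔-trans (eA ⊎-↔ eB) (↔-sym Finₚ.+↔⊎)

  card-Σ : {B : A → Set} → Card A m → (∀ a → Card (B a) c) → Card (Σ A B) (m * c)
  card-Σ eA eB = ↔-trans (Σ-↔ eA (λ {a} → eB a)) (↔-sym Finₚ.*↔×)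

  card-Vec : Card A n → ∀ k → Card (Vec A k) (n ^ k)
  card-Vec e zero    = mk↔ₛ′ (λ _ → zero) (λ _ → []) (λ { zero → refl }) (λ { [] → refl })
  card-Vec e (suc k) = ↔-trans uncons (card-Σ e (λ _ → card-Vec e k))
    where
    uncons : Vec _ (suc k) ↔ (_ × Vec _ k)
    uncons = mk↔ₛ′ (λ { (x ∷ xs) → x , xs }) (λ (x , xs) → x ∷ xs)
                   (λ _ → refl) (λ { (x ∷ xs) → refl })

  module _ (e : Card A n) where
    open Inverse e

    card⇒≟ : DecidableEquality A
    card⇒≟ x y = map′ (λ p → trans (sym (strictlyInverseʳ x)) (trans (cong from p) (strictlyInverseʳ y)))
                      (cong to) (to x Finₚ.≟ to y)

    all? : {P : A → Set} → Decidable P → Dec (∀ a → P a)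
    all? {P} P? = map′ (λ ∀P a → subst P (strictlyInverseʳ a) (∀P (to a))) (λ ∀P i → ∀P (from i))
                   (Finₚ.all? (P? ∘ from))

    any? : {P : A → Set} → Decidable P → Dec (∃ P)
    any? {P} P? = map′ (λ (i , p) → from i , p) (λ (a , p) → to a , subst P (sym (strictlyInverseʳ a)) p)
                   (Finₚ.any? (P? ∘ from))

  Subtype : (A : Set) → (A → Bool) → Set
  Subtype A P = Σ A (T ∘ P)

  _⊆_ : (P Q : A → Bool) → Set
  P ⊆ Q = ∀ a → T (P a) → T (Q a)

  _∖_ : (P Q : A → Bool) → A → Bool
  (P ∖ Q) a = P a ∧ not (Q a)

  ∧-not-intro : ∀ {x y} → T x → ¬ T y → T (x ∧ not y)
  ∧-not-intro {true} {false} _ _  = tt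
  ∧-not-intro {true} {true}  _ ¬y = ¬y tt

  ∧-not-elim : ∀ {x y} → T (x ∧ not y) → T x × ¬ T y
  ∧-not-elim {true} {false} _ = tt , λ ()

  sub-≡ : {P : A → Bool} {a a′ : A} {p : T (P a)} {p′ : T (P a′)} →
          a ≡ a′ → _≡_ {A = Subtype A P} (a , p) (a′ , p′)
  sub-≡ {p = p} {p′} refl = cong (_ ,_) (T-irrelevant p p′)

  sub-full : Subtype A (λ _ → true) ↔ A
  sub-full = mk↔ₛ′ proj₁ (_, tt) (λ _ → refl) (λ _ → refl)

  sub-↔ : (e : A ↔ B) (P : A → Bool) → Subtype A P ↔ Subtype B (P ∘ Inverse.from e)
  sub-↔ e P = mk↔ₛ′ (λ (a , p) → to a , subst (T ∘ P) (sym (strictlyInverseʳ a)) p)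
                    (λ (b , p) → from b , p)
                    (λ (b , _) → sub-≡ (strictlyInverseˡ b)) (λ (a , _) → sub-≡ (strictlyInverseʳ a))
    where open Inverse e

  sub-⊎-∖ : (P Q : A → Bool) → Q ⊆ P → Subtype A P ↔ (Subtype A Q ⊎ Subtype A (P ∖ Q))
  sub-⊎-∖ {A} P Q Q⊆P = mk↔ₛ′ to from to∘from from∘to
    where
    split : (a : A) → T (P a) → Dec (T (Q a)) → Subtype A Q ⊎ Subtype A (P ∖ Q)
    split a p (yes q) = inj₁ (a , q)
    split a p (no ¬q) = inj₂ (a , ∧-not-intro p ¬q)

    to : Subtype A P → Subtype A Q ⊎ Subtype A (P ∖ Q)
    to (a , p) = split a p (T? (Q a))

    from : Subtype A Q ⊎ Subtype A (P ∖ Q) → Subtype A P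
    from (inj₁ (a , q)) = a , Q⊆P a q
    from (inj₂ (a , p)) = a , proj₁ (∧-not-elim p)

    from∘to : ∀ x → from (to x) ≡ x
    from∘to (a , p) with T? (Q a)
    ... | yes _ = sub-≡ refl
    ... | no _  = sub-≡ refl

    to∘from : ∀ y → to (from y) ≡ y
    to∘from (inj₁ (a , q)) with T? (Q a)
    ... | yes _ = cong inj₁ (sub-≡ refl)
    ... | no ¬q = contradiction q ¬q
    to∘from (inj₂ (a , p)) with T? (Q a)
    ... | yes q = contradiction q (proj₂ (∧-not-elim p))
    ... | no _  = cong inj₂ (sub-≡ refl)

  private
    card-T : ∀ b → ∃ λ k → Card (T b) k
    card-T true  = 1 , card-⊤
    card-T false = 0 , mk↔ₛ′ (λ ()) (λ ()) (λ ()) (λ ())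

    card-sub-Fin : ∀ n (P : Fin n → Bool) → ∃ λ m → Card (Subtype (Fin n) P) m
    card-sub-Fin zero    P = 0 , mk↔ₛ′ (λ { (() , _) }) (λ ()) (λ ()) (λ { (() , _) })
    card-sub-Fin (suc n) P with card-T (P zero) | card-sub-Fin n (P ∘ suc)
    ... | k , e | m , e′ = k + m , ↔-trans peel (card-⊎ e e′)
      where
      peel : Subtype (Fin (suc n)) P ↔ (T (P zero) ⊎ Subtype (Fin n) (P ∘ suc))
      peel = mk↔ₛ′ (λ { (zero , p) → inj₁ p ; (suc i , p) → inj₂ (i , p) })
                   (λ { (inj₁ p) → zero , p ; (inj₂ (i , p)) → suc i , p })
                   (λ { (inj₁ _) → refl ; (inj₂ _) → refl })
                   (λ { (zero , _) → refl ; (suc _ , _) → refl })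

  module _ (e : Card A n) where

    card-sub : (P : A → Bool) → ∃ λ m → Card (Subtype A P) m
    card-sub P with card-sub-Fin n (P ∘ Inverse.from e)
    ... | m , e′ = m , ↔-trans (sub-↔ e P) e′

    card-split : {P Q : A → Bool} → Q ⊆ P → Card (Subtype A P) m → Card (Subtype A Q) c →
                 ∃ λ d → Card (Subtype A (P ∖ Q)) d × m ≡ c + d
    card-split {P = P} {Q} Q⊆P eP eQ with card-sub (P ∖ Q)
    ... | d , eD = d , eD , card-unique eP (↔-trans (sub-⊎-∖ P Q Q⊆P) (card-⊎ eQ eD))

    card-∖ : {P Q : A → Bool} → Q ⊆ P → Card (Subtype A P) m → Card (Subtype A Q) c →
             Card (Subtype A (P ∖ Q)) (m ∸ c)
    card-∖ {c = c} Q⊆P eP eQ with card-split Q⊆P eP eQ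
    ... | d , eD , refl = subst (Card _) (sym (m+n∸m≡n c d)) eD

    ⊆-card-≡ : {P Q : A → Bool} → Q ⊆ P → Card (Subtype A P) m → Card (Subtype A Q) m → P ⊆ Q
    ⊆-card-≡ {m = m} {P} {Q} Q⊆P eP eQ a p with T? (Q a) | card-split Q⊆P eP eQ
    ... | yes q | _ = q
    ... | no ¬q | d , eD , m≡m+d = ⊥-elim (card-empty (subst (Card _) d≡0 eD) (a , ∧-not-intro p ¬q))
      where
      d≡0 : d ≡ 0
      d≡0 = +-cancelˡ-≡ m _ _ (trans (sym m≡m+d) (sym (+-identityʳ m)))

    ⁅_⁆ : A → A → Bool
    ⁅ a ⁆ x = ⌊ card⇒≟ e x a ⌋

    card-∖⁅⁆ : {P : A → Bool} {a : A} → T (P a) → Card (Subtype A P) m →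
               Card (Subtype A (P ∖ ⁅ a ⁆)) (m ∸ 1)
    card-∖⁅⁆ {P = P} {a} pa eP = card-∖ (λ x x≡a → subst (T ∘ P) (sym (toWitness x≡a)) pa) eP singleton
      where
      singleton : Card (Subtype A ⁅ a ⁆) 1
      singleton = ↔-trans (mk↔ₛ′ (λ _ → tt) (λ _ → a , fromWitness refl) (λ _ → refl)
                                  (λ (x , x≡a) → sub-≡ (sym (toWitness x≡a))))
                          card-⊤

  T⇒≡true : ∀ {x} → T x → x ≡ true
  T⇒≡true = Equivalence.to T-≡

  ≡true⇒T : ∀ {x} → x ≡ true → T x
  ≡true⇒T = Equivalence.from T-≡

  T-ext : ∀ {x y} → (T x → T y) → (T y → T x) → x ≡ y
  T-ext {false} {false} _ _ = refl
  T-ext {false} {true}  _ g = ⊥-elim (g tt)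
  T-ext {true}  {false} f _ = ⊥-elim (f tt)
  T-ext {true}  {true}  _ _ = refl

open FiniteSets

module Orbits where
  open Data.Nat using (_+_; _*_)
  open ℕₚ using (≤-refl; ≤-trans; ≤-pred; +-monoˡ-≤; *-distribʳ-+)

  module _ {A B : Set} (f : A → B) where

    Fibre : B → Set
    Fibre b = Σ A λ a → f a ≡ b

    Σ-Fibre↔ : (S : B → Bool) → (∀ a → T (S (f a))) → Σ (Subtype B S) (Fibre ∘ proj₁) ↔ A
    Σ-Fibre↔ S f∈S = mk↔ₛ′ (proj₁ ∘ proj₂) (λ a → (f a , f∈S a) , a , refl) (λ _ → refl) from∘to
      where
      from∘to : ∀ x → ((f (proj₁ (proj₂ x)) , f∈S _) , proj₁ (proj₂ x) , refl) ≡ x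
      from∘to ((_ , s) , a , refl) = cong (λ s → (f a , s) , a , refl) (T-irrelevant (f∈S a) s)

    Fibre-≡ : UIP B → ∀ {b} {u v : Fibre b} → proj₁ u ≡ proj₁ v → u ≡ v
    Fibre-≡ uip {u = a , e} {v = .a , e′} refl = cong (a ,_) (uip e e′)

    card-by-fibres : {S : B → Bool} {m s c : ℕ} → (∀ a → T (S (f a))) →
                     Card A m → Card (Subtype B S) s → (∀ b → T (S b) → Card (Fibre b) c) → m ≡ s * c
    card-by-fibres f∈S eA eS eFibre =
      card-unique eA (↔-trans (↔-sym (Σ-Fibre↔ _ f∈S)) (card-Σ eS (λ (b , p) → eFibre b p)))

  record Representatives {A : Set} (R : A → A → Bool) (S : A → Bool) (k : ℕ) : Set where
    field
      rep        : Fin k → A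
      rep∈       : ∀ i → T (S (rep i))
      rep-apart  : ∀ i j → T (R (rep i) (rep j)) → i ≡ j
      rep-covers : ∀ a → T (S a) → ∃ λ i → T (R a (rep i))

  Closed : {A : Set} → (A → A → Bool) → (A → Bool) → Set
  Closed R S = ∀ {a b} → T (S a) → T (R a b) → T (S b)

  module _ {A : Set} (R : A → A → Bool)
           (R-sym : ∀ {a b} → T (R a b) → T (R b a))
           (R-trans : ∀ {a b c} → T (R a b) → T (R b c) → T (R a c)) where

    Closed-∖ : ∀ {S} x → Closed R S → Closed R (S ∖ R x)
    Closed-∖ x S-closed p r with ∧-not-elim p
    ... | sa , ¬xa = ∧-not-intro (S-closed sa r) (¬xa ∘ λ xb → R-trans xb (R-sym r))

    representatives-∷ : ∀ {S k} x → T (S x) → Representatives R (S ∖ R x) k →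
                        Representatives R S (suc k)
    representatives-∷ {S} x sx reps = record
      { rep = rep′ ; rep∈ = rep∈′ ; rep-apart = apart ; rep-covers = covers }
      where
      open Representatives reps
      rep′ : Fin _ → A
      rep′ zero    = x
      rep′ (suc i) = rep i
      rep∈′ : ∀ i → T (S (rep′ i))
      rep∈′ zero    = sx
      rep∈′ (suc i) = proj₁ (∧-not-elim (rep∈ i))
      apart : ∀ i j → T (R (rep′ i) (rep′ j)) → i ≡ j
      apart zero    zero    _ = refl
      apart zero    (suc j) r = contradiction r (proj₂ (∧-not-elim (rep∈ j)))
      apart (suc i) zero    r = contradiction (R-sym r) (proj₂ (∧-not-elim (rep∈ i)))
      apart (suc i) (suc j) r = cong suc (rep-apart i j r)
      covers : ∀ a → T (S a) → ∃ λ i → T (R a (rep′ i))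
      covers a sa with T? (R x a)
      ... | yes xa = zero , R-sym xa
      ... | no ¬xa = let i , r = rep-covers a (∧-not-intro sa ¬xa) in suc i , r

    module _ {n} (eA : Card A n) (d e : ℕ) where

      ReflexiveOn : (A → Bool) → Set
      ReflexiveOn S = ∀ a → T (S a) → T (R a a)

      ClassSizes : (A → Bool) → Set
      ClassSizes S = ∀ a → T (S a) → ∃ λ c → Card (Subtype A (R a)) c × c * d ≡ e

      private
        class-nonempty : ∀ {x c} → T (R x x) → Card (Subtype A (R x)) c → 1 ≤ c
        class-nonempty {x} {zero}  xx eC = ⊥-elim (card-empty eC (x , xx))
        class-nonempty {c = suc _} _  _  = s≤s z≤n

        rest-≤ : ∀ {c m m′ t} → 1 ≤ c → suc m ≡ c + m′ → m ≤ t → m′ ≤ t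
        rest-≤ {m′ = m′} 1≤c m≡c+m′ m≤t =
          ≤-trans (≤-pred (subst (suc m′ ≤_) (sym m≡c+m′) (+-monoˡ-≤ m′ 1≤c))) m≤t

        count : ∀ t {m} S → m ≤ t → Closed R S → ReflexiveOn S → ClassSizes S → Card (Subtype A S) m →
                ∃ λ k → Representatives R S k × k * e ≡ m * d
        count t {zero} S _ _ _ _ eS = 0 , none , refl
          where
          none : Representatives R S 0
          none = record { rep = λ () ; rep∈ = λ () ; rep-apart = λ ()
                        ; rep-covers = λ a sa → ⊥-elim (card-empty eS (a , sa)) }
        count (suc t) {suc m} S (s≤s m≤t) closed refl-on sizes eS
          with x , sx ← Inverse.from eS zero
          with c , eC , cd≡e ← sizes x sx
          with m′ , eS′ , m≡c+m′ ← card-split eA (λ _ → closed sx) eS eC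
          with k , reps , ke≡m′d ← count t (S ∖ R x) (rest-≤ (class-nonempty (refl-on x sx) eC) m≡c+m′ m≤t)
                                         (Closed-∖ x closed) (λ a → refl-on a ∘ proj₁ ∘ ∧-not-elim)
                                         (λ a → sizes a ∘ proj₁ ∘ ∧-not-elim) eS′
          = suc k , representatives-∷ x sx reps , counted
          where
          counted : suc k * e ≡ suc m * d
          counted = begin
            e + k * e       ≡⟨ cong₂ _+_ (sym cd≡e) ke≡m′d ⟩
            c * d + m′ * d  ≡⟨ sym (*-distribʳ-+ d c m′) ⟩
            (c + m′) * d    ≡⟨ cong (_* d) (sym m≡c+m′) ⟩
            suc m * d       ∎
            where open ≡-Reasoning

      orbit-count : ∀ {m} S → Closed R S → ReflexiveOn S → ClassSizes S → Card (Subtype A S) m →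
                    ∃ λ k → Representatives R S k × k * e ≡ m * d
      orbit-count {m} S = count m S ≤-refl

open Orbits

module FieldProperties (K : Field) where
  open Field K

  commutativeRing : CommutativeRing 0ℓ 0ℓ
  commutativeRing = record { isCommutativeRing = isCommutativeRing }

  open CommutativeRing commutativeRing public
    using (+-identityˡ; +-identityʳ; -‿inverseʳ; *-assoc; *-comm; *-identityˡ; *-identityʳ;
           distribˡ; distribʳ; zeroˡ; zeroʳ)
  open RingProperties (CommutativeRing.ring commutativeRing) public
    using (-‿distribˡ-*; -‿distribʳ-*; -1*x≈-x; x+x≈x⇒x≈0)
  open GroupProperties (CommutativeRing.+-group commutativeRing) public
    using (inverseˡ-unique; inverseʳ-unique; x∙y⁻¹≈ε⇒x≈y)
  open CommutativeSemigroupProperties (CommutativeRing.+-commutativeSemigroup commutativeRing) public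
    using () renaming (interchange to +-interchange)
  open CommutativeSemigroupProperties (CommutativeRing.*-commutativeSemigroup commutativeRing) public
    using () renaming (x∙yz≈y∙xz to x*[y*z]≡y*[x*z])

  open ≡-Reasoning

  *-cancelˡ : ∀ {x y z} → x ≢ 0# → x * y ≡ x * z → y ≡ z
  *-cancelˡ {x} {y} {z} x≢0 xy≡xz with inverse x x≢0
  ... | x′ , xx′≡1 = begin
    y              ≡⟨ sym (*-identityˡ y) ⟩
    1# * y         ≡⟨ cong (_* y) (trans (sym xx′≡1) (*-comm x x′)) ⟩
    x′ * x * y     ≡⟨ *-assoc x′ x y ⟩
    x′ * (x * y)   ≡⟨ cong (x′ *_) xy≡xz ⟩
    x′ * (x * z)   ≡⟨ sym (*-assoc x′ x z) ⟩
    x′ * x * z     ≡⟨ cong (_* z) (trans (*-comm x′ x) xx′≡1) ⟩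
    1# * z         ≡⟨ *-identityˡ z ⟩
    z              ∎

  *-≢0 : ∀ {x y} → x ≢ 0# → y ≢ 0# → x * y ≢ 0#
  *-≢0 {x} x≢0 y≢0 xy≡0 = y≢0 (*-cancelˡ x≢0 (trans xy≡0 (sym (zeroʳ x))))

  module Reciprocal (_≟_ : DecidableEquality Carrier) where

    infix 8 _⁻¹
    _⁻¹ : Carrier → Carrier
    x ⁻¹ with x ≟ 0#
    ... | yes _   = 0#
    ... | no x≢0 = proj₁ (inverse x x≢0)

    ⁻¹-inverseʳ : ∀ {x} → x ≢ 0# → x * x ⁻¹ ≡ 1#
    ⁻¹-inverseʳ {x} x≢0 with x ≟ 0#
    ... | yes x≡0  = contradiction x≡0 x≢0
    ... | no x≢0′ = proj₂ (inverse x x≢0′)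

    ⁻¹-≢0 : ∀ {x} → x ≢ 0# → x ⁻¹ ≢ 0#
    ⁻¹-≢0 {x} x≢0 x⁻¹≡0 = 0≢1 (begin
      0#          ≡⟨ sym (zeroʳ x) ⟩
      x * 0#      ≡⟨ cong (x *_) (sym x⁻¹≡0) ⟩
      x * x ⁻¹    ≡⟨ ⁻¹-inverseʳ x≢0 ⟩
      1#          ∎)

    ⁻¹-cancelʳ : ∀ {x} y → x ≢ 0# → x * (x ⁻¹ * y) ≡ y
    ⁻¹-cancelʳ {x} y x≢0 = begin
      x * (x ⁻¹ * y)  ≡⟨ sym (*-assoc x (x ⁻¹) y) ⟩
      x * x ⁻¹ * y    ≡⟨ cong (_* y) (⁻¹-inverseʳ x≢0) ⟩
      1# * y          ≡⟨ *-identityˡ y ⟩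
      y               ∎

    ⁻¹-cancelˡ : ∀ {x} y → x ≢ 0# → x ⁻¹ * (x * y) ≡ y
    ⁻¹-cancelˡ {x} y x≢0 = *-cancelˡ x≢0 (⁻¹-cancelʳ (x * y) x≢0)

module HomProperties {F K : Field} (h : FieldHom F K) where
  private
    module F = Field F
    module K = Field K
    module Fₚ = FieldProperties F
    module Kₚ = FieldProperties K
  open FieldHom h

  ι-0 : ι F.0# ≡ K.0#
  ι-0 = Kₚ.x+x≈x⇒x≈0 (ι F.0#) (trans (sym (ι-+ F.0# F.0#)) (cong ι (Fₚ.+-identityˡ F.0#)))

  ι-neg : ∀ a → ι (F.- a) ≡ K.- ι a
  ι-neg a = Kₚ.inverseʳ-unique (ι a) (ι (F.- a))
              (trans (sym (ι-+ a (F.- a))) (trans (cong ι (Fₚ.-‿inverseʳ a)) ι-0))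

  ι-≢0 : ∀ {a} → a ≢ F.0# → ι a ≢ K.0#
  ι-≢0 {a} a≢0 ιa≡0 with F.inverse a a≢0
  ... | a′ , aa′≡1 = K.0≢1 (begin
    K.0#              ≡⟨ sym (Kₚ.zeroˡ (ι a′)) ⟩
    K.0# K.* ι a′     ≡⟨ cong (K._* ι a′) (sym ιa≡0) ⟩
    ι a K.* ι a′      ≡⟨ sym (ι-* a a′) ⟩
    ι (a F.* a′)      ≡⟨ cong ι aa′≡1 ⟩
    ι F.1#            ≡⟨ ι-1 ⟩
    K.1#              ∎)
    where open ≡-Reasoning

  ι-injective : DecidableEquality F.Carrier → ∀ {a b} → ι a ≡ ι b → a ≡ b
  ι-injective _≟_ {a} {b} ιa≡ιb = Fₚ.x∙y⁻¹≈ε⇒x≈y a b (decidable-stable (_ ≟ F.0#) ι[a-b]≢0⇒⊥)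
    where
    ι[a-b]≢0⇒⊥ : ¬ (a F.+ F.- b ≢ F.0#)
    ι[a-b]≢0⇒⊥ a-b≢0 = ι-≢0 a-b≢0
      (trans (ι-+ a (F.- b)) (trans (cong₂ K._+_ ιa≡ιb (ι-neg b)) (Kₚ.-‿inverseʳ (ι b))))

module LinearAlgebra {F K : Field} (h : FieldHom F K) {q Q : ℕ} (eF : Card ⟨ F ⟩ q) (eK : Card ⟨ K ⟩ Q) where
  private
    module F = Field F
    module K = Field K
    module Fₚ = FieldProperties F
    module Kₚ = FieldProperties K
  open FieldHom h
  open HomProperties h
  open Subspaces h using (lincomb; IsSubspace)
  open Data.Nat using (_*_; _^_)
  open ≡-Reasoning

  private variable
    k : ℕ

  _≟F_ : DecidableEquality ⟨ F ⟩
  _≟F_ = card⇒≟ eF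

  _≟K_ : DecidableEquality ⟨ K ⟩
  _≟K_ = card⇒≟ eK

  lc : Vec ⟨ F ⟩ k → Vec ⟨ K ⟩ k → ⟨ K ⟩
  lc []      []      = K.0#
  lc (a ∷ c) (x ∷ b) = ι a K.* x K.+ lc c b

  lc-tabulate : (c : Fin k → ⟨ F ⟩) (b : Fin k → ⟨ K ⟩) → lc (tabulate c) (tabulate b) ≡ lincomb c b
  lc-tabulate {zero}  c b = refl
  lc-tabulate {suc k} c b = cong (ι (c Fin.zero) K.* b Fin.zero K.+_) (lc-tabulate (c ∘ Fin.suc) (b ∘ Fin.suc))

  infixl 6 _+ᶜ_
  infixr 7 _·ᶜ_ _·ᵛ_

  _+ᶜ_ : Vec ⟨ F ⟩ k → Vec ⟨ F ⟩ k → Vec ⟨ F ⟩ k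
  _+ᶜ_ = zipWith F._+_

  _·ᶜ_ : ⟨ F ⟩ → Vec ⟨ F ⟩ k → Vec ⟨ F ⟩ k
  s ·ᶜ c = map (s F.*_) c

  0ᶜ : Vec ⟨ F ⟩ k
  0ᶜ = replicate _ F.0#

  _·ᵛ_ : ⟨ K ⟩ → Vec ⟨ K ⟩ k → Vec ⟨ K ⟩ k
  β ·ᵛ b = map (β K.*_) b

  lc-+ᶜ : (c c′ : Vec ⟨ F ⟩ k) (b : Vec ⟨ K ⟩ k) → lc (c +ᶜ c′) b ≡ lc c b K.+ lc c′ b
  lc-+ᶜ []       []         []      = sym (Kₚ.+-identityˡ K.0#)
  lc-+ᶜ (a ∷ c) (a′ ∷ c′) (x ∷ b) = begin
    ι (a F.+ a′) K.* x K.+ lc (c +ᶜ c′) b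
      ≡⟨ cong₂ K._+_ (trans (cong (K._* x) (ι-+ a a′)) (Kₚ.distribʳ x (ι a) (ι a′))) (lc-+ᶜ c c′ b) ⟩
    (ι a K.* x K.+ ι a′ K.* x) K.+ (lc c b K.+ lc c′ b)
      ≡⟨ Kₚ.+-interchange _ _ _ _ ⟩
    (ι a K.* x K.+ lc c b) K.+ (ι a′ K.* x K.+ lc c′ b) ∎

  lc-·ᶜ : ∀ s (c : Vec ⟨ F ⟩ k) (b : Vec ⟨ K ⟩ k) → lc (s ·ᶜ c) b ≡ ι s K.* lc c b
  lc-·ᶜ s []       []      = sym (Kₚ.zeroʳ (ι s))
  lc-·ᶜ s (a ∷ c) (x ∷ b) = begin
    ι (s F.* a) K.* x K.+ lc (s ·ᶜ c) b
      ≡⟨ cong₂ K._+_ (trans (cong (K._* x) (ι-* s a)) (Kₚ.*-assoc (ι s) (ι a) x)) (lc-·ᶜ s c b) ⟩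
    ι s K.* (ι a K.* x) K.+ ι s K.* lc c b
      ≡⟨ sym (Kₚ.distribˡ (ι s) _ _) ⟩
    ι s K.* (ι a K.* x K.+ lc c b) ∎

  lc-0ᶜ : (b : Vec ⟨ K ⟩ k) → lc 0ᶜ b ≡ K.0#
  lc-0ᶜ []      = refl
  lc-0ᶜ (x ∷ b) = begin
    ι F.0# K.* x K.+ lc 0ᶜ b  ≡⟨ cong₂ K._+_ (trans (cong (K._* x) ι-0) (Kₚ.zeroˡ x)) (lc-0ᶜ b) ⟩
    K.0# K.+ K.0#             ≡⟨ Kₚ.+-identityˡ K.0# ⟩
    K.0#                      ∎

  lc-·ᵛ : (c : Vec ⟨ F ⟩ k) (β : ⟨ K ⟩) (b : Vec ⟨ K ⟩ k) → lc c (β ·ᵛ b) ≡ β K.* lc c b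
  lc-·ᵛ []       β []      = sym (Kₚ.zeroʳ β)
  lc-·ᵛ (a ∷ c) β (x ∷ b) = begin
    ι a K.* (β K.* x) K.+ lc c (β ·ᵛ b)
      ≡⟨ cong₂ K._+_ (Kₚ.x*[y*z]≡y*[x*z] (ι a) β x) (lc-·ᵛ c β b) ⟩
    β K.* (ι a K.* x) K.+ β K.* lc c b
      ≡⟨ sym (Kₚ.distribˡ β _ _) ⟩
    β K.* (ι a K.* x K.+ lc c b) ∎

  ·ᵛ-·ᵛ : ∀ β γ (v : Vec ⟨ K ⟩ k) → β ·ᵛ (γ ·ᵛ v) ≡ (β K.* γ) ·ᵛ v
  ·ᵛ-·ᵛ β γ []      = refl
  ·ᵛ-·ᵛ β γ (x ∷ v) = cong₂ _∷_ (sym (Kₚ.*-assoc β γ x)) (·ᵛ-·ᵛ β γ v)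

  1·ᵛ : (v : Vec ⟨ K ⟩ k) → K.1# ·ᵛ v ≡ v
  1·ᵛ []      = refl
  1·ᵛ (x ∷ v) = cong₂ _∷_ (Kₚ.*-identityˡ x) (1·ᵛ v)

  x+ι[-1]x≡0 : ∀ x → x K.+ ι (F.- F.1#) K.* x ≡ K.0#
  x+ι[-1]x≡0 x = begin
    x K.+ ι (F.- F.1#) K.* x  ≡⟨ cong (λ y → x K.+ y K.* x) (trans (ι-neg F.1#) (cong K.-_ ι-1)) ⟩
    x K.+ K.- K.1# K.* x      ≡⟨ cong (x K.+_) (Kₚ.-1*x≈-x x) ⟩
    x K.+ K.- x               ≡⟨ Kₚ.-‿inverseʳ x ⟩
    K.0#                      ∎

  +ᶜ-[-1]·ᶜ≡0ᶜ⇒≡ : (c c′ : Vec ⟨ F ⟩ k) → c +ᶜ (F.- F.1#) ·ᶜ c′ ≡ 0ᶜ → c ≡ c′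
  +ᶜ-[-1]·ᶜ≡0ᶜ⇒≡ []       []         _  = refl
  +ᶜ-[-1]·ᶜ≡0ᶜ⇒≡ (a ∷ c) (a′ ∷ c′) eq =
    cong₂ _∷_ a≡a′ (+ᶜ-[-1]·ᶜ≡0ᶜ⇒≡ c c′ (Vec.∷-injectiveʳ eq))
    where
    a≡a′ : a ≡ a′
    a≡a′ = Fₚ.x∙y⁻¹≈ε⇒x≈y a a′
             (trans (cong (a F.+_) (sym (Fₚ.-1*x≈-x a′))) (Vec.∷-injectiveˡ eq))

  Independent : Vec ⟨ K ⟩ k → Set
  Independent b = ∀ c → lc c b ≡ K.0# → c ≡ 0ᶜ

  independent? : Decidable (Independent {k})
  independent? {k} b = all? (card-Vec eF k) λ c → lc c b ≟K K.0# →-dec Vec.≡-dec _≟F_ c 0ᶜ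

  InSpan : Vec ⟨ K ⟩ k → ⟨ K ⟩ → Set
  InSpan b x = ∃ λ c → lc c b ≡ x

  inSpan? : (b : Vec ⟨ K ⟩ k) → Decidable (InSpan b)
  inSpan? {k} b x = any? (card-Vec eF k) (λ c → lc c b ≟K x)

  span : Vec ⟨ K ⟩ k → ⟨ K ⟩ → Bool
  span b x = ⌊ inSpan? b x ⌋

  lc∈span : ∀ (c : Vec ⟨ F ⟩ k) b → T (span b (lc c b))
  lc∈span c b = fromWitness (c , refl)

  lc-injective : ∀ {b : Vec ⟨ K ⟩ k} → Independent b → ∀ {c c′} → lc c b ≡ lc c′ b → c ≡ c′
  lc-injective {b = b} ind {c} {c′} eq = +ᶜ-[-1]·ᶜ≡0ᶜ⇒≡ c c′ (ind _ (begin
    lc (c +ᶜ (F.- F.1#) ·ᶜ c′) b         ≡⟨ lc-+ᶜ c _ b ⟩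
    lc c b K.+ lc ((F.- F.1#) ·ᶜ c′) b    ≡⟨ cong (lc c b K.+_) (lc-·ᶜ _ c′ b) ⟩
    lc c b K.+ ι (F.- F.1#) K.* lc c′ b   ≡⟨ cong (λ y → lc c b K.+ ι (F.- F.1#) K.* y) (sym eq) ⟩
    lc c b K.+ ι (F.- F.1#) K.* lc c b    ≡⟨ x+ι[-1]x≡0 (lc c b) ⟩
    K.0#                                  ∎))

  card-span : ∀ {b : Vec ⟨ K ⟩ k} → Independent b → Card (Subtype ⟨ K ⟩ (span b)) (q ^ k)
  card-span {k} {b} ind = ↔-trans coordinates (card-Vec eF k)
    where
    coordinates : Subtype ⟨ K ⟩ (span b) ↔ Vec ⟨ F ⟩ k
    coordinates = mk↔ₛ′ (λ (_ , p) → proj₁ (toWitness p)) (λ c → lc c b , lc∈span c b)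
                        (λ c → lc-injective ind (proj₂ (toWitness (lc∈span c b))))
                        (λ (_ , p) → sub-≡ (proj₂ (toWitness p)))

  span-isSubspace : (b : Vec ⟨ K ⟩ k) → IsSubspace (span b)
  span-isSubspace b = record
    { zero∈ = T⇒≡true (fromWitness (0ᶜ , lc-0ᶜ b))
    ; +∈    = λ x y x∈ y∈ → let c , cb≡x = toWitness (≡true⇒T x∈)
                                c′ , c′b≡y = toWitness (≡true⇒T y∈) in
                T⇒≡true (fromWitness (c +ᶜ c′ , trans (lc-+ᶜ c c′ b) (cong₂ K._+_ cb≡x c′b≡y)))
    ; ·∈    = λ s x x∈ → let c , cb≡x = toWitness (≡true⇒T x∈) in
                T⇒≡true (fromWitness (s ·ᶜ c , trans (lc-·ᶜ s c b) (cong (ι s K.*_) cb≡x)))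
    }

  lc∈subspace : ∀ {V} → IsSubspace V → {b : Vec ⟨ K ⟩ k} → All (T ∘ V) b → ∀ c → T (V (lc c b))
  lc∈subspace V-sub []         []      = ≡true⇒T (IsSubspace.zero∈ V-sub)
  lc∈subspace V-sub (x∈ ∷ b∈) (a ∷ c) =
    ≡true⇒T (IsSubspace.+∈ V-sub _ _ (IsSubspace.·∈ V-sub a _ (T⇒≡true x∈))
                                     (T⇒≡true (lc∈subspace V-sub b∈ c)))

  span-⊆ : ∀ {V} → IsSubspace V → {b : Vec ⟨ K ⟩ k} → All (T ∘ V) b → span b ⊆ V
  span-⊆ {V = V} V-sub b∈ x p = let c , cb≡x = toWitness p in subst (T ∘ V) cb≡x (lc∈subspace V-sub b∈ c)

  private
    ι0*x+y≡y : ∀ x y → ι F.0# K.* x K.+ y ≡ y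
    ι0*x+y≡y x y = trans (cong (λ z → z K.* x K.+ y) ι-0) (trans (cong (K._+ y) (Kₚ.zeroˡ x)) (Kₚ.+-identityˡ y))

    ι1*x≡x : ∀ x → ι F.1# K.* x ≡ x
    ι1*x≡x x = trans (cong (K._* x) ι-1) (Kₚ.*-identityˡ x)

  span-∷ : ∀ x (v : Vec ⟨ K ⟩ k) → span v ⊆ span (x ∷ v)
  span-∷ x v y p = let c , cv≡y = toWitness p in fromWitness (F.0# ∷ c , trans (ι0*x+y≡y x _) cv≡y)

  head∈span : ∀ x (v : Vec ⟨ K ⟩ k) → T (span (x ∷ v) x)
  head∈span x v = fromWitness (F.1# ∷ 0ᶜ , trans (cong₂ K._+_ (ι1*x≡x x) (lc-0ᶜ v)) (Kₚ.+-identityʳ x))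

  ∈-span : (b : Vec ⟨ K ⟩ k) → All (T ∘ span b) b
  ∈-span []      = []
  ∈-span (x ∷ v) = head∈span x v ∷ All.map (λ {y} → span-∷ x v y) (∈-span v)

  subspace-·-invariant : ∀ {V} → IsSubspace V → ∀ {s} → s ≢ F.0# → ∀ x → V x ≡ V (ι s K.* x)
  subspace-·-invariant {V} V-sub {s} s≢0 x with F.inverse s s≢0
  ... | s′ , ss′≡1 = T-ext (λ p → ≡true⇒T (IsSubspace.·∈ V-sub s x (T⇒≡true p)))
                           (λ p → subst (T ∘ V) s′sx≡x (≡true⇒T (IsSubspace.·∈ V-sub s′ _ (T⇒≡true p))))
    where
    s′sx≡x : ι s′ K.* (ι s K.* x) ≡ x
    s′sx≡x = begin
      ι s′ K.* (ι s K.* x)  ≡⟨ sym (Kₚ.*-assoc _ _ x) ⟩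
      ι s′ K.* ι s K.* x    ≡⟨ cong (K._* x) (sym (ι-* s′ s)) ⟩
      ι (s′ F.* s) K.* x    ≡⟨ cong (λ z → ι z K.* x) (trans (Fₚ.*-comm s′ s) ss′≡1) ⟩
      ι F.1# K.* x          ≡⟨ ι1*x≡x x ⟩
      x                     ∎

  independent-tail : ∀ {x} {v : Vec ⟨ K ⟩ k} → Independent (x ∷ v) → Independent v
  independent-tail {x = x} ind c cv≡0 = Vec.∷-injectiveʳ (ind (F.0# ∷ c) (trans (ι0*x+y≡y x _) cv≡0))

  independent-head : ∀ {x} {v : Vec ⟨ K ⟩ k} → Independent (x ∷ v) → ¬ T (span v x)
  independent-head {x = x} {v} ind p with toWitness p
  ... | c , cv≡x = F.0≢1 (sym (Vec.∷-injectiveˡ (ind (F.1# ∷ (F.- F.1#) ·ᶜ c) (begin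
    ι F.1# K.* x K.+ lc ((F.- F.1#) ·ᶜ c) v  ≡⟨ cong₂ K._+_ (ι1*x≡x x) (lc-·ᶜ _ c v) ⟩
    x K.+ ι (F.- F.1#) K.* lc c v           ≡⟨ cong (λ y → x K.+ ι (F.- F.1#) K.* y) cv≡x ⟩
    x K.+ ι (F.- F.1#) K.* x                ≡⟨ x+ι[-1]x≡0 x ⟩
    K.0#                                    ∎))))

  independent-∷ : ∀ {x} {v : Vec ⟨ K ⟩ k} → Independent v → ¬ T (span v x) → Independent (x ∷ v)
  independent-∷ {x = x} {v} ind x∉ (a ∷ c) eq with a ≟F F.0#
  ... | yes a≡0 = cong₂ _∷_ a≡0
                    (ind c (trans (sym (ι0*x+y≡y x _)) (subst (λ a → ι a K.* x K.+ lc c v ≡ K.0#) a≡0 eq)))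
  ... | no a≢0 with F.inverse a a≢0
  ...   | a′ , aa′≡1 = contradiction (fromWitness ((F.- a′) ·ᶜ c , x≡lc)) x∉
    where
    x≡lc : lc ((F.- a′) ·ᶜ c) v ≡ x
    x≡lc = begin
      lc ((F.- a′) ·ᶜ c) v       ≡⟨ lc-·ᶜ _ c v ⟩
      ι (F.- a′) K.* lc c v      ≡⟨ cong (K._* lc c v) (ι-neg a′) ⟩
      K.- ι a′ K.* lc c v        ≡⟨ trans (sym (Kₚ.-‿distribˡ-* _ _)) (Kₚ.-‿distribʳ-* _ _) ⟩
      ι a′ K.* K.- lc c v        ≡⟨ cong (ι a′ K.*_) (sym (Kₚ.inverseˡ-unique _ _ eq)) ⟩
      ι a′ K.* (ι a K.* x)       ≡⟨ sym (Kₚ.*-assoc _ _ x) ⟩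
      ι a′ K.* ι a K.* x         ≡⟨ cong (K._* x) (sym (ι-* a′ a)) ⟩
      ι (a′ F.* a) K.* x         ≡⟨ cong (λ z → ι z K.* x) (trans (Fₚ.*-comm a′ a) aa′≡1) ⟩
      ι F.1# K.* x               ≡⟨ ι1*x≡x x ⟩
      x                          ∎

  span-·ᵛ⁺ : ∀ {β x} {b : Vec ⟨ K ⟩ k} → T (span b x) → T (span (β ·ᵛ b) (β K.* x))
  span-·ᵛ⁺ {β = β} {b = b} p = let c , cb≡x = toWitness p in
    fromWitness (c , trans (lc-·ᵛ c β b) (cong (β K.*_) cb≡x))

  span-·ᵛ⁻ : ∀ {β x} {b : Vec ⟨ K ⟩ k} → β ≢ K.0# → T (span (β ·ᵛ b) (β K.* x)) → T (span b x)
  span-·ᵛ⁻ {β = β} {b = b} β≢0 p = let c , cβb≡βx = toWitness p in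
    fromWitness (c , Kₚ.*-cancelˡ β≢0 (trans (sym (lc-·ᵛ c β b)) cβb≡βx))

  span-·ᵛ : ∀ {β x} {b : Vec ⟨ K ⟩ k} → β ≢ K.0# → span (β ·ᵛ b) (β K.* x) ≡ span b x
  span-·ᵛ {b = b} β≢0 = T-ext (span-·ᵛ⁻ {b = b} β≢0) span-·ᵛ⁺

  independent-·ᵛ : ∀ {β} {b : Vec ⟨ K ⟩ k} → β ≢ K.0# → Independent b → Independent (β ·ᵛ b)
  independent-·ᵛ {β = β} {b} β≢0 ind c cβb≡0 =
    ind c (Kₚ.*-cancelˡ β≢0 (trans (sym (lc-·ᵛ c β b)) (trans cβb≡0 (sym (Kₚ.zeroʳ β)))))

  IndependentIn : (⟨ K ⟩ → Bool) → Vec ⟨ K ⟩ k → Set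
  IndependentIn V v = All (T ∘ V) v × Independent v

  independentIn? : (V : ⟨ K ⟩ → Bool) → Decidable (IndependentIn {k} V)
  independentIn? V v = All.all? (T? ∘ V) v ×-dec independent? v

  independentIn : (⟨ K ⟩ → Bool) → Vec ⟨ K ⟩ k → Bool
  independentIn V v = ⌊ independentIn? V v ⌋

  -- the (i+1)-st vector of an independent tuple avoids the q^i-element span of the first i
  #independent : ℕ → ℕ → ℕ
  #independent m zero    = 1
  #independent m (suc k) = #independent m k * (m ∸ q ^ k)

  card-independentIn : ∀ {V m} → IsSubspace V → Card (Subtype ⟨ K ⟩ V) m →
                       ∀ k → Card (Subtype (Vec ⟨ K ⟩ k) (independentIn V)) (#independent m k)
  card-independentIn {V} V-sub eV zero =
    ↔-trans (mk↔ₛ′ _ (λ _ → [] , fromWitness ([] , λ { [] _ → refl }))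
                   (λ _ → refl) (λ { ([] , _) → sub-≡ refl }))
            card-⊤
  card-independentIn {V} V-sub eV (suc k) =
    ↔-trans extend (card-Σ (card-independentIn V-sub eV k) λ (v , p) →
      card-∖ eK (span-⊆ V-sub (proj₁ (toWitness p))) eV (card-span (proj₂ (toWitness p))))
    where
    Extension : Subtype (Vec ⟨ K ⟩ k) (independentIn V) → Set
    Extension (v , _) = Subtype ⟨ K ⟩ (V ∖ span v)

    to : Subtype (Vec ⟨ K ⟩ (suc k)) (independentIn V) → Σ _ Extension
    to (x ∷ v , p) = let x∈v∈ , ind = toWitness p in
      (v , fromWitness (All.tail x∈v∈ , independent-tail ind)) ,
      (x , ∧-not-intro (All.head x∈v∈) (independent-head ind))

    from : Σ _ Extension → Subtype (Vec ⟨ K ⟩ (suc k)) (independentIn V)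
    from ((v , p) , (x , q)) = let v∈ , ind = toWitness p ; x∈ , x∉ = ∧-not-elim q in
      x ∷ v , fromWitness (x∈ ∷ v∈ , independent-∷ ind x∉)

    extend : Subtype (Vec ⟨ K ⟩ (suc k)) (independentIn V) ↔ Σ _ Extension
    extend = mk↔ₛ′ to from
      (λ ((v , _) , (x , _)) → cong₂ (λ p q → (v , p) , (x , q)) (T-irrelevant _ _) (T-irrelevant _ _))
      (λ { (x ∷ v , _) → sub-≡ refl })

module Dilations (K : Field) {Q : ℕ} (eK : Card ⟨ K ⟩ Q) where
  open Field K
  open FieldProperties K
  infix 4 _≟_
  _≟_ : DecidableEquality Carrier
  _≟_ = card⇒≟ eK
  open Reciprocal _≟_

  private variable
    X Y Z : Carrier → Bool
    x y : Carrier

  nonzero : Carrier → Bool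
  nonzero = (λ _ → true) ∖ ⁅_⁆ eK 0#

  nonzero⇒≢0 : T (nonzero x) → x ≢ 0#
  nonzero⇒≢0 {x} p = proj₂ (∧-not-elim {y = ⁅_⁆ eK 0# x} p) ∘ fromWitness

  ≢0⇒nonzero : x ≢ 0# → T (nonzero x)
  ≢0⇒nonzero {x} x≢0 = ∧-not-intro {y = ⁅_⁆ eK 0# x} _ (x≢0 ∘ toWitness)

  card-nonzero : Card (Subtype Carrier nonzero) (Q ∸ 1)
  card-nonzero = card-∖⁅⁆ eK _ (↔-trans sub-full eK)

  record Dilation (X Y : Carrier → Bool) (β : Carrier) : Set where
    constructor dilation
    field
      factor≢0 : β ≢ 0#
      maps     : ∀ x → X x ≡ Y (β * x)

  dilation? : ∀ X Y → Decidable (Dilation X Y)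
  dilation? X Y β = map′ (uncurry dilation) (λ (dilation β≢0 f) → β≢0 , f)
                         (¬? (β ≟ 0#) ×-dec all? eK (λ x → X x Bool.≟ Y (β * x)))

  dilation-refl : Dilation X X 1#
  dilation-refl {X} = dilation (λ 1≡0 → 0≢1 (sym 1≡0)) λ x → cong X (sym (*-identityˡ x))

  dilation-sym : ∀ {β} → Dilation X Y β → Dilation Y X (β ⁻¹)
  dilation-sym {X} {Y} {β} (dilation β≢0 X≡Yβ) =
    dilation (⁻¹-≢0 β≢0) λ y → sym (trans (X≡Yβ (β ⁻¹ * y)) (cong Y (⁻¹-cancelʳ y β≢0)))

  dilation-trans : ∀ {β γ} → Dilation X Y β → Dilation Y Z γ → Dilation X Z (γ * β)
  dilation-trans {Z = Z} {β} {γ} (dilation β≢0 X≡Yβ) (dilation γ≢0 Y≡Zγ) =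
    dilation (*-≢0 γ≢0 β≢0) λ x → trans (X≡Yβ x) (trans (Y≡Zγ (β * x)) (cong Z (sym (*-assoc γ β x))))

  dilation-⁻¹∈ : ∀ {β} → Dilation X Y β → T (Y y) → T (X (β ⁻¹ * y))
  dilation-⁻¹∈ {X} {Y} {y} {β} (dilation β≢0 X≡Yβ) y∈Y =
    subst T (sym (trans (X≡Yβ (β ⁻¹ * y)) (cong Y (⁻¹-cancelʳ y β≢0)))) y∈Y

  Stab : (Carrier → Bool) → Carrier → Bool
  Stab X z = ⌊ dilation? X X z ⌋

  SameOrbit : (Carrier → Bool) → Carrier → Carrier → Set
  SameOrbit X x y = ∃ λ z → Dilation X X z × y ≡ x * z

  sameOrbit? : ∀ X x → Decidable (SameOrbit X x)
  sameOrbit? X x y = any? eK (λ z → dilation? X X z ×-dec y ≟ x * z)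

  sameOrbit : (Carrier → Bool) → Carrier → Carrier → Bool
  sameOrbit X x y = ⌊ sameOrbit? X x y ⌋

  sameOrbit-refl : ∀ x → T (sameOrbit X x x)
  sameOrbit-refl x = fromWitness (1# , dilation-refl , sym (*-identityʳ x))

  sameOrbit-sym : T (sameOrbit X x y) → T (sameOrbit X y x)
  sameOrbit-sym {x = x} p with toWitness p
  ... | z , stab@(dilation z≢0 _) , refl = fromWitness (z ⁻¹ , dilation-sym stab , sym xzz⁻¹≡x)
    where
    xzz⁻¹≡x : x * z * z ⁻¹ ≡ x
    xzz⁻¹≡x = trans (*-assoc x z (z ⁻¹)) (trans (cong (x *_) (⁻¹-inverseʳ z≢0)) (*-identityʳ x))

  sameOrbit-trans : ∀ {w} → T (sameOrbit X x y) → T (sameOrbit X y w) → T (sameOrbit X x w)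
  sameOrbit-trans {X} {x} p p′ with toWitness p | toWitness p′
  ... | z , stab , refl | z′ , stab′ , refl =
    fromWitness (z′ * z , dilation-trans stab stab′ , trans (*-assoc x z z′) (cong (x *_) (*-comm z z′)))

  card-orbit : ∀ {s} → x ≢ 0# → Card (Subtype Carrier (Stab X)) s → Card (Subtype Carrier (sameOrbit X x)) s
  card-orbit {x} {X = X} x≢0 eStab = ↔-trans orbit↔Stab eStab
    where
    orbit↔Stab : Subtype Carrier (sameOrbit X x) ↔ Subtype Carrier (Stab X)
    orbit↔Stab = mk↔ₛ′
      (λ (y , p) → let z , stab , y≡xz = toWitness p
                       x⁻¹y≡z = trans (cong (x ⁻¹ *_) y≡xz) (⁻¹-cancelˡ z x≢0) in
                   x ⁻¹ * y , fromWitness (subst (Dilation X X) (sym x⁻¹y≡z) stab))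
      (λ (z , p) → x * z , fromWitness (z , toWitness p , refl))
      (λ (z , _) → sub-≡ (⁻¹-cancelˡ z x≢0))
      (λ (y , _) → sub-≡ (⁻¹-cancelʳ y x≢0))

  Stab-∣ : ∀ {X S s m} → Card (Subtype Carrier (Stab X)) s → (∀ {x} → T (S x) → x ≢ 0#) →
           Closed (sameOrbit X) S → Card (Subtype Carrier S) m → s ∣ m
  Stab-∣ {X} {S} {s} {m} eStab S≢0 closed eS
    with k , _ , ks≡m*1 ← orbit-count (sameOrbit X) sameOrbit-sym sameOrbit-trans eK 1 s S closed
                            (λ a _ → sameOrbit-refl a) (λ a p → s , card-orbit (S≢0 p) eStab , ℕₚ.*-identityʳ s) eS
    = divides k (sym (trans ks≡m*1 (ℕₚ.*-identityʳ m)))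

module SpanStabilizer {F K : Field} (h : FieldHom F K) {q Q : ℕ} (eF : Card ⟨ F ⟩ q) (eK : Card ⟨ K ⟩ Q)
  {r : ℕ} (bound : ∀ {d} → d ∣ q ℕ.^ r ∸ 1 → d ∣ Q ∸ 1 → d ≤ q ∸ 1) where
  private
    module F = Field F
    module K = Field K
    module F* = Dilations F eF
  open FieldProperties K
  open FieldHom h
  open HomProperties h
  open LinearAlgebra h eF eK
  open Dilations K eK
  open Subspaces h using (IsSubspace)

  card-Stab-span : {b : Vec K.Carrier r} → Independent b → Card (Subtype K.Carrier (Stab (span b))) (q ∸ 1)
  card-Stab-span {b} ind with s , eStab ← card-sub eK (Stab (span b)) =
    subst (Card _) (ℕₚ.≤-antisym (bound (Stab-∣ eStab X*≢0 X*-closed card-X*)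
                                       (Stab-∣ eStab nonzero⇒≢0 nonzero-closed card-nonzero))
                                q-1≤s)
          eStab
    where
    X : K.Carrier → Bool
    X = span b

    X* : K.Carrier → Bool
    X* = X ∖ ⁅_⁆ eK K.0#

    X*≢0 : ∀ {x} → T (X* x) → x ≢ K.0#
    X*≢0 {x} p = proj₂ (∧-not-elim {x = X x} p) ∘ fromWitness

    card-X* : Card (Subtype K.Carrier X*) (q ℕ.^ r ∸ 1)
    card-X* = card-∖⁅⁆ eK (≡true⇒T (IsSubspace.zero∈ (span-isSubspace b))) (card-span ind)

    X*-closed : Closed (sameOrbit X) X*
    X*-closed {a} p p′ with toWitness p′ | ∧-not-elim {x = X a} p
    ... | z , (dilation z≢0 X≡Xz) , refl | a∈X , a≢0 =
      ∧-not-intro (subst T (trans (X≡Xz a) (cong X (*-comm z a))) a∈X)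
                  (*-≢0 (X*≢0 p) z≢0 ∘ toWitness)

    nonzero-closed : Closed (sameOrbit X) nonzero
    nonzero-closed p p′ with toWitness p′
    ... | z , (dilation z≢0 _) , refl = ≢0⇒nonzero (*-≢0 (nonzero⇒≢0 p) z≢0)

    ι-dilation : ∀ {a} → a ≢ F.0# → Dilation X X (ι a)
    ι-dilation a≢0 = dilation (ι-≢0 a≢0) (subspace-·-invariant (span-isSubspace b) a≢0)

    q-1≤s : q ∸ 1 ≤ s
    q-1≤s = card-injective-≤ F*.card-nonzero eStab
              (λ (a , p) → ι a , fromWitness (ι-dilation (F*.nonzero⇒≢0 p)))
              (λ ιa≡ιa′ → sub-≡ (ι-injective (card⇒≟ eF) (cong proj₁ ιa≡ιa′)))

module TupleClasses {F K : Field} (h : FieldHom F K) {q Q : ℕ} (eF : Card ⟨ F ⟩ q) (eK : Card ⟨ K ⟩ Q)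
  {r : ℕ} (bound : ∀ {d} → d ∣ q ℕ.^ r ∸ 1 → d ∣ Q ∸ 1 → d ≤ q ∸ 1) where
  open Field K
  open FieldProperties K
  open LinearAlgebra h eF eK
  open Dilations K eK
  open Reciprocal _≟_
  open SpanStabilizer h eF eK {r} bound
  open Subspaces h using (IsSubspace)

  Tuple : Set
  Tuple = Vec Carrier r

  Related : Tuple → Tuple → Set
  Related b b′ = Independent b × Independent b′ × ∃ (Dilation (span b) (span b′))

  related? : ∀ b → Decidable (Related b)
  related? b b′ = independent? b ×-dec independent? b′ ×-dec any? eK (dilation? (span b) (span b′))

  related : Tuple → Tuple → Bool
  related b b′ = ⌊ related? b b′ ⌋

  related-sym : ∀ {b b′} → T (related b b′) → T (related b′ b)
  related-sym p with toWitness p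
  ... | ind , ind′ , β , dil = fromWitness (ind′ , ind , β ⁻¹ , dilation-sym dil)

  related-trans : ∀ {b b′ b″} → T (related b b′) → T (related b′ b″) → T (related b b″)
  related-trans {b″ = b″} p p′ with toWitness p | toWitness p′
  ... | ind , _ , β , dil | _ , ind″ , γ , dil′ =
    fromWitness (ind , ind″ , γ * β , dilation-trans dil dil′)

  Basis : Tuple → Tuple → Bool
  Basis b = independentIn (span b)

  span-Basis : ∀ {b c} → Independent b → T (Basis b c) → ∀ x → span c x ≡ span b x
  span-Basis {b} {c} ind p x with toWitness p
  ... | c∈X , ind′ = T-ext (span-c⊆X x) (⊆-card-≡ eK span-c⊆X (card-span ind) (card-span ind′) x)
    where
    span-c⊆X : span c ⊆ span b
    span-c⊆X = span-⊆ (span-isSubspace b) c∈X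

  #bases : ℕ
  #bases = #independent (q ℕ.^ r) r

  card-Basis : ∀ {b} → Independent b → Card (Subtype Tuple (Basis b)) #bases
  card-Basis {b} ind = card-independentIn (span-isSubspace b) (card-span ind) r

  ScaledBasis : Tuple → Set
  ScaledBasis b = Subtype Carrier nonzero × Subtype Tuple (Basis b)

  scale : ∀ {b} → ScaledBasis b → Tuple
  scale ((β , _) , (c , _)) = β ·ᵛ c

  ⁻¹·ᵛ-cancel : ∀ {β} → β ≢ 0# → (v : Tuple) → β ⁻¹ ·ᵛ (β ·ᵛ v) ≡ v
  ⁻¹·ᵛ-cancel {β} β≢0 v =
    trans (·ᵛ-·ᵛ _ β v) (trans (cong (_·ᵛ v) (trans (*-comm _ β) (⁻¹-inverseʳ β≢0))) (1·ᵛ v))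

  ·ᵛ-⁻¹-cancel : ∀ {β} → β ≢ 0# → (v : Tuple) → β ·ᵛ (β ⁻¹ ·ᵛ v) ≡ v
  ·ᵛ-⁻¹-cancel {β} β≢0 v = trans (·ᵛ-·ᵛ β _ v) (trans (cong (_·ᵛ v) (⁻¹-inverseʳ β≢0)) (1·ᵛ v))

  module _ {b : Tuple} (ind : Independent b) where

    scale-dilation : (s : ScaledBasis b) → Dilation (span b) (span (scale s)) (proj₁ (proj₁ s))
    scale-dilation ((β , p) , (c , pc)) =
      dilation (nonzero⇒≢0 p) λ x → trans (sym (span-Basis ind pc x)) (sym (span-·ᵛ {b = c} (nonzero⇒≢0 p)))

    scale-related : (s : ScaledBasis b) → T (related b (scale s))
    scale-related s@((β , p) , (c , pc)) =
      fromWitness (ind , independent-·ᵛ (nonzero⇒≢0 p) (proj₂ (toWitness pc)) , β , scale-dilation s)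

    -- β ↦ β₀⁻¹ β for one fixed β₀ with span b′ = β₀ · span b
    fibre↔Stab : ∀ {b′} → T (related b b′) → Fibre scale b′ ↔ Subtype Carrier (Stab (span b))
    fibre↔Stab {b′} p with toWitness p
    ... | _ , ind′ , β₀ , dil₀@(dilation β₀≢0 _) = mk↔ₛ′ to from to∘from from∘to
      where
      to : Fibre scale b′ → Subtype Carrier (Stab (span b))
      to (s@((β , _) , _) , s≡b′) = β₀ ⁻¹ * β , fromWitness (dilation-trans dil (dilation-sym dil₀))
        where
        dil : Dilation (span b) (span b′) β
        dil = subst (λ v → Dilation (span b) (span v) β) s≡b′ (scale-dilation s)

      from : Subtype Carrier (Stab (span b)) → Fibre scale b′
      from (γ , pγ) = ((β₀ * γ , ≢0⇒nonzero β₀γ≢0) , (β₀ * γ) ⁻¹ ·ᵛ b′ , basis) , ·ᵛ-⁻¹-cancel β₀γ≢0 b′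
        where
        dil : Dilation (span b) (span b′) (β₀ * γ)
        dil = dilation-trans (toWitness pγ) dil₀
        β₀γ≢0 : β₀ * γ ≢ 0#
        β₀γ≢0 = Dilation.factor≢0 dil
        basis : T (Basis b ((β₀ * γ) ⁻¹ ·ᵛ b′))
        basis = fromWitness (All.map⁺ (All.map (dilation-⁻¹∈ dil) (∈-span b′)) , independent-·ᵛ (⁻¹-≢0 β₀γ≢0) ind′)

      to∘from : ∀ g → to (from g) ≡ g
      to∘from (γ , _) = sub-≡ (⁻¹-cancelˡ γ β₀≢0)

      from∘to : ∀ x → from (to x) ≡ x
      from∘to (((β , p) , (c , _)) , refl) = Fibre-≡ scale uip (cong₂ _,_ (sub-≡ β₀β₀⁻¹β≡β) (sub-≡ (begin
        (β₀ * (β₀ ⁻¹ * β)) ⁻¹ ·ᵛ (β ·ᵛ c)  ≡⟨ cong (λ δ → δ ⁻¹ ·ᵛ (β ·ᵛ c)) β₀β₀⁻¹β≡β ⟩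
        β ⁻¹ ·ᵛ (β ·ᵛ c)                   ≡⟨ ⁻¹·ᵛ-cancel (nonzero⇒≢0 p) c ⟩
        c                                   ∎)))
        where
        open ≡-Reasoning
        β₀β₀⁻¹β≡β : β₀ * (β₀ ⁻¹ * β) ≡ β
        β₀β₀⁻¹β≡β = ⁻¹-cancelʳ β β₀≢0
        uip : UIP Tuple
        uip = Decidable⇒UIP.≡-irrelevant (Vec.≡-dec _≟_)

    card-class : ∃ λ c → Card (Subtype Tuple (related b)) c × c ℕ.* (q ∸ 1) ≡ (Q ∸ 1) ℕ.* #bases
    card-class with c , eC ← card-sub (card-Vec eK r) (related b) =
      c , eC , sym (card-by-fibres scale scale-related (card-Σ card-nonzero (λ _ → card-Basis ind)) eC
                     (λ b′ p → ↔-trans (fibre↔Stab p) (card-Stab-span ind)))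

  full : Carrier → Bool
  full _ = true

  full-isSubspace : IsSubspace full
  full-isSubspace = record { zero∈ = refl ; +∈ = λ _ _ _ _ → refl ; ·∈ = λ _ _ _ → refl }

  independent⇒full : ∀ {b : Tuple} → Independent b → T (independentIn full b)
  independent⇒full {b} ind = fromWitness (All.universal (λ _ → _) b , ind)

  independent-classes : ∃ λ k → Representatives related (independentIn full) k ×
                                k ℕ.* ((Q ∸ 1) ℕ.* #bases) ≡ #independent Q r ℕ.* (q ∸ 1)
  independent-classes =
    orbit-count related related-sym related-trans (card-Vec eK r) (q ∸ 1) ((Q ∸ 1) ℕ.* #bases)
      (independentIn full)
      (λ _ p → independent⇒full (proj₁ (proj₂ (toWitness p))))
      (λ b p → let ind = proj₂ (toWitness p) in fromWitness (ind , ind , 1# , dilation-refl))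
      (λ b p → card-class (proj₂ (toWitness p)))
      (card-independentIn full-isSubspace (↔-trans sub-full eK) r)

module SubspaceClasses {F K : Field} (h : FieldHom F K) {q Q : ℕ} (eF : Card ⟨ F ⟩ q) (eK : Card ⟨ K ⟩ Q)
  {r′ : ℕ} (bound : ∀ {d} → d ∣ q ℕ.^ suc r′ ∸ 1 → d ∣ Q ∸ 1 → d ≤ q ∸ 1) where
  private
    module F = Field F
  open Field K
  open FieldProperties K
  open LinearAlgebra h eF eK
  open Dilations K eK
  open Reciprocal _≟_
  open TupleClasses h eF eK {suc r′} bound
  open Subspaces h using (_∈_; Sub; IsSubspace; IsBasis; _≐_·_; E; lincomb)
  open Sub

  subspace : (b : Tuple) → Independent b → Sub (suc r′)
  subspace b ind = record
    { set = span b
    ; isSubspace = span-isSubspace b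
    ; basis = lookup b
    ; isBasis = record
      { in-X = T⇒≡true ∘ All.lookup⁺ (∈-span b)
      ; independent = λ c lincomb≡0 i → begin
          c i                          ≡⟨ sym (Vec.lookup∘tabulate c i) ⟩
          lookup (tabulate c) i        ≡⟨ cong (λ v → lookup v i) (ind (tabulate c) (begin
            lc (tabulate c) b                      ≡⟨ cong (lc (tabulate c)) (sym (Vec.tabulate∘lookup b)) ⟩
            lc (tabulate c) (tabulate (lookup b))  ≡⟨ lc-tabulate c (lookup b) ⟩
            lincomb c (lookup b)                   ≡⟨ lincomb≡0 ⟩
            0#                                     ∎)) ⟩
          lookup (replicate _ F.0#) i  ≡⟨ Vec.lookup-replicate i F.0# ⟩
          F.0#                         ∎
      ; spanning = λ x x∈ → let c , cb≡x = toWitness (≡true⇒T x∈) in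
          lookup c , trans (sym (lc-tabulate (lookup c) (lookup b)))
                           (trans (cong₂ lc (Vec.tabulate∘lookup c) (Vec.tabulate∘lookup b)) cb≡x)
      }
    }
    where open ≡-Reasoning

  tuple : Sub (suc r′) → Tuple
  tuple X = tabulate (basis X)

  lc-tuple : (X : Sub (suc r′)) (c : Vec F.Carrier (suc r′)) → lc c (tuple X) ≡ lincomb (lookup c) (basis X)
  lc-tuple X c = trans (cong (λ v → lc v (tuple X)) (sym (Vec.tabulate∘lookup c))) (lc-tabulate (lookup c) (basis X))

  tuple-independent : (X : Sub (suc r′)) → Independent (tuple X)
  tuple-independent X c c·X≡0 = begin
    c                      ≡⟨ sym (Vec.tabulate∘lookup c) ⟩
    tabulate (lookup c)    ≡⟨ Vec.tabulate-cong (λ i → trans (coordinates≡0 i) (sym (Vec.lookup-replicate i F.0#))) ⟩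
    tabulate (lookup 0ᶜ)   ≡⟨ Vec.tabulate∘lookup 0ᶜ ⟩
    0ᶜ                     ∎
    where
    open ≡-Reasoning
    coordinates≡0 : ∀ i → lookup c i ≡ F.0#
    coordinates≡0 = IsBasis.independent (isBasis X) (lookup c) (trans (sym (lc-tuple X c)) c·X≡0)

  set≡span : (X : Sub (suc r′)) → ∀ x → set X x ≡ span (tuple X) x
  set≡span X x = T-ext
    (λ p → let c , c·X≡x = IsBasis.spanning (isBasis X) x (T⇒≡true p) in
           fromWitness (tabulate c , trans (lc-tabulate c (basis X)) c·X≡x))
    (span-⊆ (isSubspace X) tuple⊆X x)
    where
    tuple⊆X : All (T ∘ set X) (tuple X)
    tuple⊆X = All.lookup⁻ λ i → subst (T ∘ set X) (sym (Vec.lookup∘tabulate (basis X) i))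
                                      (≡true⇒T (IsBasis.in-X (isBasis X) i))

  Dilation⇒≐ : ∀ {X Y β} → Dilation X Y β → Y ≐ β · X
  Dilation⇒≐ {X} {Y} {β} (dilation β≢0 X≡Yβ) y = mk⇔
    (λ y∈Y → β ⁻¹ * y , trans (X≡Yβ _) (trans (cong Y (⁻¹-cancelʳ y β≢0)) y∈Y) , sym (⁻¹-cancelʳ y β≢0))
    (λ (x , x∈X , y≡βx) → trans (cong Y y≡βx) (trans (sym (X≡Yβ x)) x∈X))

  ≐⇒Dilation : ∀ {X Y β} → β ≢ 0# → Y ≐ β · X → Dilation X Y β
  ≐⇒Dilation {X} {Y} {β} β≢0 Y≐βX = dilation β≢0 λ x → T-ext
    (λ p → ≡true⇒T (Equivalence.from (Y≐βX (β * x)) (x , T⇒≡true p , refl)))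
    (λ p → let x′ , x′∈X , βx≡βx′ = Equivalence.to (Y≐βX (β * x)) (T⇒≡true p) in
           subst (T ∘ X) (sym (*-cancelˡ β≢0 βx≡βx′)) (≡true⇒T x′∈X))

  head≢0 : ∀ {x} {v : Vec Carrier r′} → Independent (x ∷ v) → x ≢ 0#
  head≢0 {v = v} ind x≡0 =
    independent-head ind (subst (T ∘ span v) (sym x≡0) (≡true⇒T (IsSubspace.zero∈ (span-isSubspace v))))

  nonzero-in-span : ∀ {b : Tuple} → Independent b → ∃ λ y → T (span b y) × y ≢ 0#
  nonzero-in-span {x ∷ v} ind = x , head∈span x v , head≢0 ind

  ≐-factor≢0 : ∀ {X Y β y} → y ∈ Y → y ≢ 0# → Y ≐ β · X → β ≢ 0#
  ≐-factor≢0 {β = β} {y} y∈Y y≢0 Y≐βX β≡0 = let x , _ , y≡βx = Equivalence.to (Y≐βX y) y∈Y in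
    y≢0 (trans y≡βx (trans (cong (_* x) β≡0) (zeroˡ x)))

  module _ (α : Carrier) (α-primitive : IsPrimitive K α) where

    E-from-dilation : ∀ {X b} (ind : Independent b) {β} → Dilation (span (tuple X)) (span b) β →
                      E α X (subspace b ind)
    E-from-dilation {X} {b} ind {β} (dilation β≢0 X≡Yβ) with α-primitive β β≢0
    ... | n , αⁿ≡β = n , Dilation⇒≐ (dilation (subst (_≢ 0#) (sym αⁿ≡β) β≢0) λ x →
                       trans (set≡span X x) (trans (X≡Yβ x) (cong (λ γ → span b (γ * x)) (sym αⁿ≡β))))

    subspace-classes : ∀ {k} → Representatives related (independentIn full) k →
                       HasExactlyNClasses (E α {suc r′}) k
    subspace-classes {k} reps = rep-subspace , apart , covers
      where
      open Representatives reps
      rep-independent : ∀ i → Independent (rep i)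
      rep-independent i = proj₂ (toWitness (rep∈ i))

      rep-subspace : Fin k → Sub (suc r′)
      rep-subspace i = subspace (rep i) (rep-independent i)

      apart : ∀ i j → E α (rep-subspace i) (rep-subspace j) → i ≡ j
      apart i j (n , Yj≐αⁿYi) =
        rep-apart i j (fromWitness (rep-independent i , rep-independent j , α ^ n , ≐⇒Dilation αⁿ≢0 Yj≐αⁿYi))
        where
        αⁿ≢0 : α ^ n ≢ 0#
        αⁿ≢0 = let y , y∈Yj , y≢0 = nonzero-in-span (rep-independent j) in
               ≐-factor≢0 (T⇒≡true y∈Yj) y≢0 Yj≐αⁿYi

      covers : ∀ X → Σ (Fin k) λ i → E α X (rep-subspace i)
      covers X = let i , p = rep-covers (tuple X) (independent⇒full (tuple-independent X)) in
                 i , E-from-dilation {X = X} (rep-independent i) (proj₂ (proj₂ (proj₂ (toWitness p))))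

    number-of-classes : ∃ λ k → HasExactlyNClasses (E α {suc r′}) k ×
                                k ℕ.* ((Q ∸ 1) ℕ.* #bases) ≡ #independent Q (suc r′) ℕ.* (q ∸ 1)
    number-of-classes = let k , reps , count = independent-classes in k , subspace-classes reps , count

module Arithmetic where
  open Data.Nat
  open ℕₚ
  open ≡-Reasoning

  ^∸^ : ∀ q i j → q ^ (i + j) ∸ q ^ i ≡ q ^ i * (q ^ j ∸ 1)
  ^∸^ q i j = begin
    q ^ (i + j) ∸ q ^ i        ≡⟨ cong₂ _∸_ (^-distribˡ-+-* q i j) (sym (*-identityʳ (q ^ i))) ⟩
    q ^ i * q ^ j ∸ q ^ i * 1  ≡⟨ sym (*-distribˡ-∸ (q ^ i) (q ^ j) 1) ⟩
    q ^ i * (q ^ j ∸ 1)        ∎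

  ^+∸1 : ∀ q a b .{{_ : NonZero q}} → q ^ (a + b) ∸ 1 ≡ q ^ b * (q ^ a ∸ 1) + (q ^ b ∸ 1)
  ^+∸1 q a b = begin
    q ^ (a + b) ∸ 1                        ≡⟨ cong (_∸ 1) (trans (^-distribˡ-+-* q a b) (*-comm (q ^ a) (q ^ b))) ⟩
    q ^ b * q ^ a ∸ 1                      ≡⟨ cong (_∸ 1) (sym (m∸n+n≡m (m≤m*n (q ^ b) (q ^ a) {{m^n≢0 q a}}))) ⟩
    (q ^ b * q ^ a ∸ q ^ b) + q ^ b ∸ 1    ≡⟨ +-∸-assoc _ (m^n>0 q b) ⟩
    (q ^ b * q ^ a ∸ q ^ b) + (q ^ b ∸ 1)  ≡⟨ cong (_+ (q ^ b ∸ 1)) q^b[q^a∸1] ⟩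
    q ^ b * (q ^ a ∸ 1) + (q ^ b ∸ 1)      ∎
    where
    q^b[q^a∸1] : q ^ b * q ^ a ∸ q ^ b ≡ q ^ b * (q ^ a ∸ 1)
    q^b[q^a∸1] = trans (cong (q ^ b * q ^ a ∸_) (sym (*-identityʳ (q ^ b)))) (sym (*-distribˡ-∸ (q ^ b) (q ^ a) 1))

  -- one Euclidean step towards gcd (q^m − 1, q^n − 1) = q^gcd(m,n) − 1
  ∣-^∸1 : ∀ {d} q a b .{{_ : NonZero q}} → d ∣ q ^ (a + b) ∸ 1 → d ∣ q ^ a ∸ 1 → d ∣ q ^ b ∸ 1
  ∣-^∸1 {d} q a b d∣q^[a+b]∸1 d∣q^a∸1 =
    ∣m+n∣m⇒∣n (subst (d ∣_) (^+∸1 q a b) d∣q^[a+b]∸1) (∣n⇒∣m*n (q ^ b) d∣q^a∸1)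

  q^4∸1 : ∀ q → q ^ 4 ∸ 1 ≡ (q ^ 2 ∸ 1) * (q ^ 2 + 1)
  q^4∸1 q = sym (begin
    (m ∸ 1) * (m + 1)        ≡⟨ *-distribʳ-∸ (m + 1) m 1 ⟩
    m * (m + 1) ∸ 1 * (m + 1) ≡⟨ cong₂ _∸_ m[m+1]≡m+m*m (*-identityˡ (m + 1)) ⟩
    (m + m * m) ∸ (m + 1)    ≡⟨ [m+n]∸[m+o]≡n∸o m (m * m) 1 ⟩
    m * m ∸ 1                ≡⟨ cong (_∸ 1) (sym (^-distribˡ-+-* q 2 2)) ⟩
    q ^ 4 ∸ 1                ∎)
    where
    m : ℕ
    m = q ^ 2
    m[m+1]≡m+m*m : m * (m + 1) ≡ m + m * m
    m[m+1]≡m+m*m = trans (*-distribˡ-+ m m 1) (trans (cong (m * m +_) (*-identityʳ m)) (+-comm (m * m) m))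

  stabilizer-bound-2 : ∀ {q d} → 2 ≤ q → d ∣ q ^ 2 ∸ 1 → d ∣ q ^ 5 ∸ 1 → d ≤ q ∸ 1
  stabilizer-bound-2 {q} {d} (s≤s (s≤s _)) d∣q²∸1 d∣q⁵∸1 =
    ∣⇒≤ (subst (d ∣_) (cong (_∸ 1) (^-identityʳ q)) (∣-^∸1 q 2 1 (∣-^∸1 q 2 3 d∣q⁵∸1 d∣q²∸1) d∣q²∸1))

  stabilizer-bound-3 : ∀ {q d} → 2 ≤ q → d ∣ q ^ 3 ∸ 1 → d ∣ q ^ 5 ∸ 1 → d ≤ q ∸ 1
  stabilizer-bound-3 {q} {d} (s≤s (s≤s _)) d∣q³∸1 d∣q⁵∸1 =
    ∣⇒≤ (subst (d ∣_) (cong (_∸ 1) (^-identityʳ q)) (∣-^∸1 q 2 1 d∣q³∸1 (∣-^∸1 q 3 2 d∣q⁵∸1 d∣q³∸1)))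

  private
    nonZero-* : ∀ {m n} → NonZero m → NonZero n → NonZero (m * n)
    nonZero-* {m} {n} m≢0 n≢0 = m*n≢0 m n {{m≢0}} {{n≢0}}

    ^∸^-nonZero : ∀ {q} → 2 ≤ q → ∀ {i j} → i < j → NonZero (q ^ j ∸ q ^ i)
    ^∸^-nonZero {q} 2≤q i<j = >-nonZero (m<n⇒0<n∸m (^-monoʳ-< q 2≤q i<j))

    q^5∸q : ∀ q → q ^ 5 ∸ q ^ 1 ≡ q ^ 1 * ((q ^ 2 ∸ 1) * (q ^ 2 + 1))
    q^5∸q q = trans (^∸^ q 1 4) (cong (q ^ 1 *_) (q^4∸1 q))

    q^[1+i]∸q^i : ∀ q i → q ^ (i + 1) ∸ q ^ i ≡ q ^ i * (q ∸ 1)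
    q^[1+i]∸q^i q i = trans (^∸^ q i 1) (cong (λ z → q ^ i * (z ∸ 1)) (^-identityʳ q))

    -- u and v stand for q ^ 1 and q ^ 2: the ring solver does not handle powers
    identity-2 : ∀ a b p u v → 1 * a * (u * (b * (v + 1))) * p ≡ (v + 1) * (a * (1 * b * (u * p)))
    identity-2 = solve-∀

    identity-3 : ∀ a b c p u v → 1 * a * (u * (b * (v + 1))) * (v * c) * p ≡ (v + 1) * (a * (1 * c * (u * b) * (v * p)))
    identity-3 = solve-∀

  orbits-2 : ∀ {q k} → 2 ≤ q →
    k * ((q ^ 5 ∸ 1) * (1 * (q ^ 2 ∸ q ^ 0) * (q ^ 2 ∸ q ^ 1))) ≡
      1 * (q ^ 5 ∸ q ^ 0) * (q ^ 5 ∸ q ^ 1) * (q ∸ 1) →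
    k ≡ q ^ 2 + 1
  orbits-2 {q} {k} 2≤q hyp = *-cancelʳ-≡ k (q ^ 2 + 1) _ {{X≢0}} (trans hyp (begin
    1 * (q ^ 5 ∸ 1) * (q ^ 5 ∸ q ^ 1) * (q ∸ 1)
      ≡⟨ cong (λ z → 1 * (q ^ 5 ∸ 1) * z * (q ∸ 1)) (q^5∸q q) ⟩
    1 * (q ^ 5 ∸ 1) * (q ^ 1 * ((q ^ 2 ∸ 1) * (q ^ 2 + 1))) * (q ∸ 1)
      ≡⟨ identity-2 (q ^ 5 ∸ 1) (q ^ 2 ∸ 1) (q ∸ 1) (q ^ 1) (q ^ 2) ⟩
    (q ^ 2 + 1) * ((q ^ 5 ∸ 1) * (1 * (q ^ 2 ∸ 1) * (q ^ 1 * (q ∸ 1))))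
      ≡⟨ cong (λ z → (q ^ 2 + 1) * ((q ^ 5 ∸ 1) * (1 * (q ^ 2 ∸ 1) * z))) (sym (q^[1+i]∸q^i q 1)) ⟩
    (q ^ 2 + 1) * ((q ^ 5 ∸ 1) * (1 * (q ^ 2 ∸ 1) * (q ^ 2 ∸ q ^ 1))) ∎))
    where
    X≢0 : NonZero ((q ^ 5 ∸ 1) * (1 * (q ^ 2 ∸ 1) * (q ^ 2 ∸ q ^ 1)))
    X≢0 = nonZero-* (^∸^-nonZero 2≤q (z<s {n = 4}))
            (nonZero-* (nonZero-* {m = 1} _ (^∸^-nonZero 2≤q (z<s {n = 1}))) (^∸^-nonZero 2≤q (s<s (z<s {n = 0}))))

  orbits-3 : ∀ {q k} → 2 ≤ q →
    k * ((q ^ 5 ∸ 1) * (1 * (q ^ 3 ∸ q ^ 0) * (q ^ 3 ∸ q ^ 1) * (q ^ 3 ∸ q ^ 2))) ≡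
      1 * (q ^ 5 ∸ q ^ 0) * (q ^ 5 ∸ q ^ 1) * (q ^ 5 ∸ q ^ 2) * (q ∸ 1) →
    k ≡ q ^ 2 + 1
  orbits-3 {q} {k} 2≤q hyp = *-cancelʳ-≡ k (q ^ 2 + 1) _ {{X≢0}} (trans hyp (begin
    1 * (q ^ 5 ∸ 1) * (q ^ 5 ∸ q ^ 1) * (q ^ 5 ∸ q ^ 2) * (q ∸ 1)
      ≡⟨ cong₂ (λ y z → 1 * (q ^ 5 ∸ 1) * y * z * (q ∸ 1)) (q^5∸q q) (^∸^ q 2 3) ⟩
    1 * (q ^ 5 ∸ 1) * (q ^ 1 * ((q ^ 2 ∸ 1) * (q ^ 2 + 1))) * (q ^ 2 * (q ^ 3 ∸ 1)) * (q ∸ 1)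
      ≡⟨ identity-3 (q ^ 5 ∸ 1) (q ^ 2 ∸ 1) (q ^ 3 ∸ 1) (q ∸ 1) (q ^ 1) (q ^ 2) ⟩
    (q ^ 2 + 1) * ((q ^ 5 ∸ 1) * (1 * (q ^ 3 ∸ 1) * (q ^ 1 * (q ^ 2 ∸ 1)) * (q ^ 2 * (q ∸ 1))))
      ≡⟨ cong₂ (λ y z → (q ^ 2 + 1) * ((q ^ 5 ∸ 1) * (1 * (q ^ 3 ∸ 1) * y * z)))
               (sym (^∸^ q 1 2)) (sym (q^[1+i]∸q^i q 2)) ⟩
    (q ^ 2 + 1) * ((q ^ 5 ∸ 1) * (1 * (q ^ 3 ∸ 1) * (q ^ 3 ∸ q ^ 1) * (q ^ 3 ∸ q ^ 2))) ∎))
    where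
    X≢0 : NonZero ((q ^ 5 ∸ 1) * (1 * (q ^ 3 ∸ 1) * (q ^ 3 ∸ q ^ 1) * (q ^ 3 ∸ q ^ 2)))
    X≢0 = nonZero-* (^∸^-nonZero 2≤q (z<s {n = 4}))
            (nonZero-* (nonZero-* (nonZero-* {m = 1} _ (^∸^-nonZero 2≤q (z<s {n = 2})))
                                  (^∸^-nonZero 2≤q (s<s (z<s {n = 1}))))
                       (^∸^-nonZero 2≤q (s<s (s<s (z<s {n = 0})))))

open Arithmetic

open Data.Nat using (_+_; _^_)

prime-power≥2 : ∀ {q} → IsPrimePower q → 2 ≤ q
prime-power≥2 (p , k , p-prime , refl) =
  ℕₚ.≤-trans (ℕ.nonTrivial⇒n>1 p {{prime⇒nonTrivial p-prime}})
             (ℕₚ.m≤m*n p (p ^ k) {{ℕₚ.m^n≢0 p k {{prime⇒nonZero p-prime}}}})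

corollary3 : (q : ℕ) → IsPrimePower q →
    (F K : Field) → HasCard F q → HasCard K (q ^ 5) →
    (h : FieldHom F K) → (α : ⟨ K ⟩) → IsPrimitive K α →
    HasExactlyNClasses (Subspaces.E h α {2}) (q ^ 2 + 1)
    × HasExactlyNClasses (Subspaces.E h α {3}) (q ^ 2 + 1)
corollary3 q q-prime-power F K cF cK h α α-primitive =
  let 2≤q = prime-power≥2 q-prime-power
      k₂ , classes₂ , count₂ = SubspaceClasses.number-of-classes h cF cK (stabilizer-bound-2 2≤q) α α-primitive
      k₃ , classes₃ , count₃ = SubspaceClasses.number-of-classes h cF cK (stabilizer-bound-3 2≤q) α α-primitive
  in subst (HasExactlyNClasses (Subspaces.E h α)) (orbits-2 2≤q count₂) classes₂ ,
     subst (HasExactlyNClasses (Subspaces.E h α)) (orbits-3 2≤q count₃) classes₃
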